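{- Let $G$ be a $(C_3,C_5)$-free graph, $R\in\mathsf{MinRed}(G)$, and $x\in\mathsf{red}(R)$. If $y\in R$ is adjacent to $x$ and $N(y)\neq\{x\}$, then at most one of the following holds: (1) $R\cap(N(y)\setminus\{x\})\neq\emptyset$; (2) $R\cap(N(x)\setminus\{y\})\neq\emptyset$. Moreover, if $y\in\mathsf{red}(R)$, then exactly one of (1) and (2) holds.
   Context: Graphs are finite, simple, undirected; $N(v),N[v]$ are open/closed neighborhoods. For $I\subseteq V(G)$ and $v\in I$, $\mathsf{priv}(v,I)=\{z\in N[v]:N[z]\cap I=\{v\}\}$. $I$ is irredundant if every element has nonempty $\mathsf{priv}$, redundant otherwise. $\mathsf{MinRed}(G)$ is the family of inclusion-wise minimal redundant sets; for redundant $R$, $\mathsf{red}(R)=\{v\in R:\mathsf{priv}(v,R)=\emptyset\}$. $(C_3,C_5)$-free means no induced cycle of length 3 or 5. -}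

module Defs where

open import Data.Nat using (ℕ; suc)
open import Data.Bool using (Bool; true; false)
open import Data.Fin using (Fin; toℕ)
open import Data.Fin.Subset using (Subset; _∈_; _⊂_)
open import Data.Product using (Σ; ∃; _×_; _,_)
open import Data.Sum using (_⊎_)
open import Data.Empty using (⊥)
open import Relation.Nullary using (¬_)
open import Relation.Binary.PropositionalEquality using (_≡_; _≢_)
open import Function.Definitions using (Injective)

_⟺_ : Set → Set → Set
A ⟺ B = (A → B) × (B → A)

record Graph : Set where
  field
    n     : ℕ
    adj   : Fin n → Fin n → Bool
    sym   : ∀ u v → adj u v ≡ adj v u
    irrefl : ∀ v → adj v v ≡ false

open Graph public

module _ (G : Graph) where

  V : Set
  V = Fin (n G)

  VSet : Set
  VSet = Subset (n G)

  Adj : V → V → Set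
  Adj u v = adj G u v ≡ true

  InClosedNbhd : V → V → Set
  InClosedNbhd z v = (z ≡ v) ⊎ Adj v z

  -- z ∈ priv(v, I) : z ∈ N[v] and N[z] ∩ I = {v}
  InPriv : VSet → V → V → Set
  InPriv I v z = InClosedNbhd z v × (∀ w → ((w ∈ I × InClosedNbhd w z) ⟺ (w ≡ v)))

  PrivNonempty : VSet → V → Set
  PrivNonempty I v = ∃ λ z → InPriv I v z

  Irredundant : VSet → Set
  Irredundant I = ∀ v → v ∈ I → PrivNonempty I v

  Redundant : VSet → Set
  Redundant I = ¬ Irredundant I

  MinRed : VSet → Set
  MinRed R = Redundant R × (∀ S → S ⊂ R → ¬ Redundant S)

  InRed : VSet → V → Set
  InRed R v = v ∈ R × ¬ PrivNonempty R v

CycAdj : (k : ℕ) → Fin k → Fin k → Set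
CycAdj k i j =
  (suc (toℕ i) ≡ toℕ j) ⊎ (suc (toℕ j) ≡ toℕ i) ⊎
  ((suc (toℕ i) ≡ k) × (toℕ j ≡ 0)) ⊎ ((suc (toℕ j) ≡ k) × (toℕ i ≡ 0))

HasInducedCycle : Graph → ℕ → Set
HasInducedCycle G k =
  Σ (Fin k → V G) λ f → Injective _≡_ _≡_ f × (∀ i j → Adj G (f i) (f j) ⟺ CycAdj k i j)

C3C5Free : Graph → Set
C3C5Free G = ¬ HasInducedCycle G 3 × ¬ HasInducedCycle G 5

-- By minimality, R - v is irredundant for every v ∈ R, so a redundant x ≠ v
-- has a private neighbour z with respect to R - v; z must be in N[v], for otherwise z would
-- already be private for x in R. For v = y, when both sides of the edge xy meet R, this z
-- can be neither x nor y, so it is a common neighbour of x and y: a triangle. When y is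
-- redundant too and neither side meets R, a third vertex v of R yields private neighbours
-- z of x and z' of y closing the induced 5-cycle x z v z' y; without a third vertex,
-- R = {x, y} and any neighbour w ≠ x of y would be a private neighbour of y.
module Submission where

open import Defs
open import Data.Fin.Subset using (_∈_)
open import Data.Product using (∃; _×_)
open import Data.Sum using (_⊎_)
open import Relation.Nullary using (¬_)
open import Relation.Binary.PropositionalEquality using (_≡_; _≢_)

open import Data.Bool using (true)
import Data.Bool as Bool
open import Data.Nat as ℕ using (suc; _<_)
open import Data.Nat.DivMod using (_mod_; _%_; m<n⇒m%n≡m; n%n≡0)
open import Data.Nat.Properties using (m≤n⇒m<n∨m≡n; <-irrefl)
open import Data.Fin using (Fin; zero; suc; toℕ)
open import Data.Fin.Properties using (any?; all?; toℕ<n; toℕ-fromℕ<; toℕ-injective)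
  renaming (_≟_ to _≟ᶠ_)
open import Data.Fin.Subset using (_-_; ⁅_⁆)
open import Data.Fin.Subset.Properties using (_∈?_; x∈p⇒p-x⊂p; x∈p∧x≢y⇒x∈p-y; p─q⊆p)
open import Data.Vec.Functional using ([]; _∷_)
open import Data.Product using (_,_; proj₁; proj₂)
open import Data.Sum using (inj₁; inj₂; [_,_]′)
open import Data.Empty using (⊥; ⊥-elim)
open import Function using (_∘_)
open import Relation.Nullary using (Dec; yes; no; contradiction)
open import Relation.Nullary.Decidable using (_⊎-dec_; _×-dec_; ¬?; from-yes; decidable-stable)
open import Relation.Binary.PropositionalEquality using (refl; cong)
import Relation.Binary.PropositionalEquality as ≡

next : ∀ {k} → Fin k → Fin k
next {suc m} i = suc (toℕ i) mod suc m

toℕ-next : ∀ {k} (i : Fin k) →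
  (suc (toℕ i) < k × toℕ (next i) ≡ suc (toℕ i)) ⊎ (suc (toℕ i) ≡ k × toℕ (next i) ≡ 0)
toℕ-next {suc m} i with m≤n⇒m<n∨m≡n (toℕ<n i)
... | inj₁ i+1<k = inj₁ (i+1<k , ≡.trans (toℕ-fromℕ< _) (m<n⇒m%n≡m i+1<k))
... | inj₂ i+1≡k = inj₂ (i+1≡k , (begin
  toℕ (next i)       ≡⟨ toℕ-fromℕ< _ ⟩
  suc (toℕ i) % suc m ≡⟨ cong (_% suc m) i+1≡k ⟩
  suc m % suc m       ≡⟨ n%n≡0 (suc m) ⟩
  0                   ∎))
  where open ≡.≡-Reasoning

≡next⇔ : ∀ {k} {i j : Fin k} →
  (j ≡ next i) ⟺ (suc (toℕ i) ≡ toℕ j ⊎ (suc (toℕ i) ≡ k × toℕ j ≡ 0))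
≡next⇔ {k} {i} {j} = to , from
  where
  to : j ≡ next i → suc (toℕ i) ≡ toℕ j ⊎ (suc (toℕ i) ≡ k × toℕ j ≡ 0)
  to refl with toℕ-next i
  ... | inj₁ (_ , next≡i+1) = inj₁ (≡.sym next≡i+1)
  ... | inj₂ wraps = inj₂ wraps
  from : suc (toℕ i) ≡ toℕ j ⊎ (suc (toℕ i) ≡ k × toℕ j ≡ 0) → j ≡ next i
  from (inj₁ i+1≡j) with toℕ-next i
  ... | inj₁ (_ , next≡i+1) = toℕ-injective (≡.trans (≡.sym i+1≡j) (≡.sym next≡i+1))
  ... | inj₂ (i+1≡k , _) = contradiction (toℕ<n j) (<-irrefl (≡.trans (≡.sym i+1≡j) i+1≡k))
  from (inj₂ (i+1≡k , j≡0)) with toℕ-next i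
  ... | inj₁ (i+1<k , _) = contradiction i+1<k (<-irrefl i+1≡k)
  ... | inj₂ (_ , next≡0) = toℕ-injective (≡.trans j≡0 (≡.sym next≡0))

cycAdj⇔next : ∀ {k} {i j : Fin k} → CycAdj k i j ⟺ (j ≡ next i ⊎ i ≡ next j)
cycAdj⇔next {k} {i} {j} = to , from
  where
  to : CycAdj k i j → j ≡ next i ⊎ i ≡ next j
  to (inj₁ forward) = inj₁ (proj₂ ≡next⇔ (inj₁ forward))
  to (inj₂ (inj₁ backward)) = inj₂ (proj₂ ≡next⇔ (inj₁ backward))
  to (inj₂ (inj₂ (inj₁ wrap-forward))) = inj₁ (proj₂ ≡next⇔ (inj₂ wrap-forward))
  to (inj₂ (inj₂ (inj₂ wrap-backward))) = inj₂ (proj₂ ≡next⇔ (inj₂ wrap-backward))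
  from : j ≡ next i ⊎ i ≡ next j → CycAdj k i j
  from (inj₁ j≡next) = [ inj₁ , inj₂ ∘ inj₂ ∘ inj₁ ]′ (proj₁ ≡next⇔ j≡next)
  from (inj₂ i≡next) = [ inj₂ ∘ inj₁ , inj₂ ∘ inj₂ ∘ inj₂ ]′ (proj₁ ≡next⇔ i≡next)

cycAdj? : ∀ k (i j : Fin k) → Dec (CycAdj k i j)
cycAdj? k i j =
  suc (toℕ i) ℕ.≟ toℕ j ⊎-dec suc (toℕ j) ℕ.≟ toℕ i ⊎-dec
  (suc (toℕ i) ℕ.≟ k ×-dec toℕ j ℕ.≟ 0) ⊎-dec (suc (toℕ j) ℕ.≟ k ×-dec toℕ i ℕ.≟ 0)

C₃-pairs : ∀ (i j : Fin 3) → i ≡ j ⊎ CycAdj 3 i j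
C₃-pairs = from-yes (all? λ i → all? λ j → i ≟ᶠ j ⊎-dec cycAdj? 3 i j)

C₅-pairs : ∀ (i j : Fin 5) → i ≡ j ⊎ CycAdj 5 i j ⊎ j ≡ next (next i) ⊎ i ≡ next (next j)
C₅-pairs = from-yes (all? λ i → all? λ j →
  i ≟ᶠ j ⊎-dec cycAdj? 5 i j ⊎-dec j ≟ᶠ next (next i) ⊎-dec i ≟ᶠ next (next j))

module _ (G : Graph) where

  Adj-irrefl : ∀ {v} → ¬ Adj G v v
  Adj-irrefl {v} vv with ≡.trans (≡.sym vv) (irrefl G v)
  ... | ()

  Adj-sym : ∀ {u v} → Adj G u v → Adj G v u
  Adj-sym {u} {v} uv = ≡.trans (sym G v u) uv

  Adj⇒≢ : ∀ {u v} → Adj G u v → u ≢ v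
  Adj⇒≢ uv refl = Adj-irrefl uv

  Adj? : ∀ u v → Dec (Adj G u v)
  Adj? u v = adj G u v Bool.≟ true

  InClosedNbhd? : ∀ z v → Dec (InClosedNbhd G z v)
  InClosedNbhd? z v = z ≟ᶠ v ⊎-dec Adj? v z

  closedWalk⇒inducedCycle : ∀ {k} (f : Fin k → V G) →
    (∀ i → Adj G (f i) (f (next i))) →
    (∀ i j → i ≢ j → ¬ CycAdj k i j → f i ≢ f j × ¬ Adj G (f i) (f j)) →
    HasInducedCycle G k
  closedWalk⇒inducedCycle {k} f step chordless =
    f , injective , λ i j → adj⇒cycAdj i j , cycAdj⇒adj i j
    where
    cycAdj⇒adj : ∀ i j → CycAdj k i j → Adj G (f i) (f j)
    cycAdj⇒adj i j ij with proj₁ cycAdj⇔next ij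
    ... | inj₁ refl = step i
    ... | inj₂ refl = Adj-sym (step j)
    adj⇒cycAdj : ∀ i j → Adj G (f i) (f j) → CycAdj k i j
    adj⇒cycAdj i j fifj with cycAdj? k i j | i ≟ᶠ j
    ... | yes ij | _ = ij
    ... | no _ | yes refl = contradiction fifj Adj-irrefl
    ... | no ¬ij | no i≢j = contradiction fifj (proj₂ (chordless i j i≢j ¬ij))
    injective : ∀ {i j} → f i ≡ f j → i ≡ j
    injective {i} {j} fi≡fj with i ≟ᶠ j | cycAdj? k i j
    ... | yes i≡j | _ = i≡j
    ... | no _ | yes ij = contradiction fi≡fj (Adj⇒≢ (cycAdj⇒adj i j ij))
    ... | no i≢j | no ¬ij = contradiction fi≡fj (proj₁ (chordless i j i≢j ¬ij))

  triangle : ∀ {a b c} → Adj G a b → Adj G b c → Adj G c a → HasInducedCycle G 3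
  triangle {a} {b} {c} ab bc ca = closedWalk⇒inducedCycle f step chordless
    where
    f : Fin 3 → V G
    f = a ∷ b ∷ c ∷ []
    step : ∀ i → Adj G (f i) (f (next i))
    step zero = ab
    step (suc zero) = bc
    step (suc (suc zero)) = ca
    chordless : ∀ i j → i ≢ j → ¬ CycAdj 3 i j → f i ≢ f j × ¬ Adj G (f i) (f j)
    chordless i j i≢j ¬ij with C₃-pairs i j
    ... | inj₁ i≡j = contradiction i≡j i≢j
    ... | inj₂ ij = contradiction ij ¬ij

  -- In a triangle-free graph every chord of a 5-cycle would close a triangle.
  pentagon : ¬ HasInducedCycle G 3 → ∀ {a b c d e} →
    Adj G a b → Adj G b c → Adj G c d → Adj G d e → Adj G e a →
    a ≢ c → b ≢ d → c ≢ e → d ≢ a → e ≢ b → HasInducedCycle G 5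
  pentagon noC₃ {a} {b} {c} {d} {e} ab bc cd de ea a≢c b≢d c≢e d≢a e≢b =
    closedWalk⇒inducedCycle f step chordless
    where
    f : Fin 5 → V G
    f = a ∷ b ∷ c ∷ d ∷ e ∷ []
    step : ∀ i → Adj G (f i) (f (next i))
    step zero = ab
    step (suc zero) = bc
    step (suc (suc zero)) = cd
    step (suc (suc (suc zero))) = de
    step (suc (suc (suc (suc zero)))) = ea
    skip-distinct : ∀ i → f i ≢ f (next (next i))
    skip-distinct zero = a≢c
    skip-distinct (suc zero) = b≢d
    skip-distinct (suc (suc zero)) = c≢e
    skip-distinct (suc (suc (suc zero))) = d≢a
    skip-distinct (suc (suc (suc (suc zero)))) = e≢b
    skip-nonadjacent : ∀ i → ¬ Adj G (f i) (f (next (next i)))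
    skip-nonadjacent i chord = noC₃ (triangle (step i) (step (next i)) (Adj-sym chord))
    chordless : ∀ i j → i ≢ j → ¬ CycAdj 5 i j → f i ≢ f j × ¬ Adj G (f i) (f j)
    chordless i j i≢j ¬ij with C₅-pairs i j
    ... | inj₁ i≡j = contradiction i≡j i≢j
    ... | inj₂ (inj₁ ij) = contradiction ij ¬ij
    ... | inj₂ (inj₂ (inj₁ refl)) = skip-distinct i , skip-nonadjacent i
    ... | inj₂ (inj₂ (inj₂ refl)) = skip-distinct j ∘ ≡.sym , skip-nonadjacent j ∘ Adj-sym

  MeetsNbhdBesides : VSet G → V G → V G → Set
  MeetsNbhdBesides R y x = ∃ λ w → w ∈ R × Adj G y w × w ≢ x

  meetsNbhdBesides? : ∀ R y x → Dec (MeetsNbhdBesides R y x)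
  meetsNbhdBesides? R y x = any? λ w → w ∈? R ×-dec Adj? y w ×-dec ¬? (w ≟ᶠ x)

  MinRed⇒¬¬Irredundant-without : ∀ {R v} → MinRed G R → v ∈ R → ¬ ¬ Irredundant G (R - v)
  MinRed⇒¬¬Irredundant-without {R} {v} (_ , minimal) v∈R = minimal (R - v) (x∈p⇒p-x⊂p v∈R)

  InPriv⇒∉ClosedNbhd : ∀ {S a z b} → InPriv G S a z → b ∈ S → b ≢ a → ¬ InClosedNbhd G b z
  InPriv⇒∉ClosedNbhd (_ , unique) b∈S b≢a b∈N[z] = b≢a (proj₁ (unique _) (b∈S , b∈N[z]))

  InPriv-without⇒InPriv : ∀ {R a v z} →
    InPriv G (R - v) a z → ¬ InClosedNbhd G v z → InPriv G R a z
  InPriv-without⇒InPriv {R} {a} {v} {z} (z∈N[a] , unique) v∉N[z] =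
    z∈N[a] , λ w → only-a w , λ w≡a → from-without (proj₂ (unique w) w≡a)
    where
    from-without : ∀ {w} → w ∈ (R - v) × InClosedNbhd G w z → w ∈ R × InClosedNbhd G w z
    from-without (w∈S , w∈N[z]) = p─q⊆p R ⁅ v ⁆ w∈S , w∈N[z]
    only-a : ∀ w → w ∈ R × InClosedNbhd G w z → w ≡ a
    only-a w (w∈R , w∈N[z]) with w ≟ᶠ v
    ... | yes refl = contradiction w∈N[z] v∉N[z]
    ... | no w≢v = proj₁ (unique w) (x∈p∧x≢y⇒x∈p-y w∈R w≢v , w∈N[z])

  InRed⇒removed∈ClosedNbhd : ∀ {R a v z} →
    InRed G R a → InPriv G (R - v) a z → InClosedNbhd G v z
  InRed⇒removed∈ClosedNbhd {v = v} {z} (_ , no-private) z-private =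
    decidable-stable (InClosedNbhd? v z)
      (λ v∉N[z] → no-private (z , InPriv-without⇒InPriv z-private v∉N[z]))

  InRed⇒common-neighbour : ∀ {R a v z} → InRed G R a → a ≢ v → ¬ Adj G a v →
    InPriv G (R - v) a z → Adj G a z × Adj G z v
  InRed⇒common-neighbour a-red a≢v ¬av z-private
    with proj₁ z-private | InRed⇒removed∈ClosedNbhd a-red z-private
  ... | inj₁ refl | v∈N[a] = ⊥-elim ([ a≢v ∘ ≡.sym , ¬av ]′ v∈N[a])
  ... | inj₂ az | inj₁ refl = contradiction az ¬av
  ... | inj₂ az | inj₂ zv = az , zv

  C₃-free⇒¬both-sides : ∀ {R x y} → ¬ HasInducedCycle G 3 → MinRed G R → InRed G R x →
    y ∈ R → Adj G x y → ¬ (MeetsNbhdBesides R y x × MeetsNbhdBesides R x y)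
  C₃-free⇒¬both-sides {R} {x} {y} noC₃ min-red x-red y∈R xy
    ((w₁ , w₁∈R , yw₁ , w₁≢x) , (w₂ , w₂∈R , xw₂ , w₂≢y)) =
    MinRed⇒¬¬Irredundant-without min-red y∈R
      λ irredundant → ¬private (proj₂ (irredundant x (x∈p∧x≢y⇒x∈p-y (proj₁ x-red) (Adj⇒≢ xy))))
    where
    ¬private : ∀ {z} → InPriv G (R - y) x z → ⊥
    ¬private z-private with proj₁ z-private | InRed⇒removed∈ClosedNbhd x-red z-private
    ... | inj₁ refl | _ = InPriv⇒∉ClosedNbhd z-private
          (x∈p∧x≢y⇒x∈p-y w₂∈R w₂≢y) (Adj⇒≢ xw₂ ∘ ≡.sym) (inj₂ xw₂)
    ... | inj₂ _ | inj₁ refl = InPriv⇒∉ClosedNbhd z-private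
          (x∈p∧x≢y⇒x∈p-y w₁∈R (Adj⇒≢ yw₁ ∘ ≡.sym)) w₁≢x (inj₂ yw₁)
    ... | inj₂ xz | inj₂ zy = noC₃ (triangle xz zy (Adj-sym xy))

  third-vertex⇒¬¬C₅ : ∀ {R x y v} → ¬ HasInducedCycle G 3 → MinRed G R →
    InRed G R x → InRed G R y → Adj G x y →
    v ∈ R → v ≢ x → v ≢ y → ¬ Adj G x v → ¬ Adj G y v → ¬ ¬ HasInducedCycle G 5
  third-vertex⇒¬¬C₅ {R} {x} {y} {v} noC₃ min-red x-red y-red xy v∈R v≢x v≢y ¬xv ¬yv noC₅ =
    MinRed⇒¬¬Irredundant-without min-red v∈R λ irredundant →
      ¬privates (proj₂ (irredundant x x∈S)) (proj₂ (irredundant y y∈S))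
    where
    x∈S : x ∈ (R - v)
    x∈S = x∈p∧x≢y⇒x∈p-y (proj₁ x-red) (v≢x ∘ ≡.sym)
    y∈S : y ∈ (R - v)
    y∈S = x∈p∧x≢y⇒x∈p-y (proj₁ y-red) (v≢y ∘ ≡.sym)
    ¬privates : ∀ {z z'} → InPriv G (R - v) x z → InPriv G (R - v) y z' → ⊥
    ¬privates {z} {z'} z-private z'-private
      with InRed⇒common-neighbour x-red (v≢x ∘ ≡.sym) ¬xv z-private
         | InRed⇒common-neighbour y-red (v≢y ∘ ≡.sym) ¬yv z'-private
    ... | xz , zv | yz' , z'v = noC₅ (pentagon noC₃
      xz zv (Adj-sym z'v) (Adj-sym yz') (Adj-sym xy)
      (v≢x ∘ ≡.sym) (λ { refl → y∉N[z] (inj₂ (Adj-sym yz')) }) v≢y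
      (x∉N[z'] ∘ inj₁ ∘ ≡.sym) (y∉N[z] ∘ inj₁))
      where
      y∉N[z] : ¬ InClosedNbhd G y z
      y∉N[z] = InPriv⇒∉ClosedNbhd z-private y∈S (Adj⇒≢ xy ∘ ≡.sym)
      x∉N[z'] : ¬ InClosedNbhd G x z'
      x∉N[z'] = InPriv⇒∉ClosedNbhd z'-private x∈S (Adj⇒≢ xy)

  C₃-free⇒neighbour-private : ∀ {R x y w} → ¬ HasInducedCycle G 3 → Adj G x y → y ∈ R →
    (∀ u → u ∈ R → u ≢ x → u ≡ y) → Adj G y w → w ≢ x → InPriv G R y w
  C₃-free⇒neighbour-private {R} {x} {y} {w} noC₃ xy y∈R R⊆xy yw w≢x =
    inj₂ yw , λ u → only-y u , λ { refl → y∈R , inj₂ (Adj-sym yw) }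
    where
    only-y : ∀ u → u ∈ R × InClosedNbhd G u w → u ≡ y
    only-y u (u∈R , u∈N[w]) with u ≟ᶠ x
    ... | no u≢x = R⊆xy u u∈R u≢x
    ... | yes refl = ⊥-elim ([ w≢x ∘ ≡.sym , (λ wx → noC₃ (triangle xy yw wx)) ]′ u∈N[w])

  C₃C₅-free⇒some-side : ∀ {R x y} → C3C5Free G → MinRed G R → InRed G R x → InRed G R y →
    Adj G x y → ¬ (∀ w → Adj G y w ⟺ (w ≡ x)) →
    ¬ MeetsNbhdBesides R y x → ¬ MeetsNbhdBesides R x y → ⊥
  C₃C₅-free⇒some-side {R} {x} {y} (noC₃ , noC₅) min-red x-red y-red xy N[y]≢⁅x⁆ ¬side₁ ¬side₂
    with any? (λ v → v ∈? R ×-dec ¬? (v ≟ᶠ x) ×-dec ¬? (v ≟ᶠ y))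
  ... | yes (v , v∈R , v≢x , v≢y) =
    third-vertex⇒¬¬C₅ noC₃ min-red x-red y-red xy v∈R v≢x v≢y
      (λ xv → ¬side₂ (v , v∈R , xv , v≢y)) (λ yv → ¬side₁ (v , v∈R , yv , v≢x)) noC₅
  ... | no ¬third = N[y]≢⁅x⁆ λ w → N[y]⊆⁅x⁆ w , λ { refl → Adj-sym xy }
    where
    R⊆xy : ∀ u → u ∈ R → u ≢ x → u ≡ y
    R⊆xy u u∈R u≢x with u ≟ᶠ y
    ... | yes u≡y = u≡y
    ... | no u≢y = contradiction (u , u∈R , u≢x , u≢y) ¬third
    N[y]⊆⁅x⁆ : ∀ w → Adj G y w → w ≡ x
    N[y]⊆⁅x⁆ w yw with w ≟ᶠ x
    ... | yes w≡x = w≡x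
    ... | no w≢x = ⊥-elim (proj₂ y-red
      (w , C₃-free⇒neighbour-private noC₃ xy (proj₁ y-red) R⊆xy yw w≢x))

lemma17 : (G : Graph) → C3C5Free G → (R : VSet G) → MinRed G R →
    (x : V G) → InRed G R x → (y : V G) → y ∈ R → Adj G x y →
    ¬ (∀ w → Adj G y w ⟺ (w ≡ x)) →
    ¬ ((∃ λ w → w ∈ R × Adj G y w × w ≢ x) × (∃ λ w → w ∈ R × Adj G x w × w ≢ y))
    × (InRed G R y →
        ((∃ λ w → w ∈ R × Adj G y w × w ≢ x) × ¬ (∃ λ w → w ∈ R × Adj G x w × w ≢ y))
        ⊎ (¬ (∃ λ w → w ∈ R × Adj G y w × w ≢ x) × (∃ λ w → w ∈ R × Adj G x w × w ≢ y)))
lemma17 G free R min-red x x-red y y∈R xy N[y]≢⁅x⁆ = ¬both , exactly-one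
  where
  ¬both : ¬ (MeetsNbhdBesides G R y x × MeetsNbhdBesides G R x y)
  ¬both = C₃-free⇒¬both-sides G (proj₁ free) min-red x-red y∈R xy
  exactly-one : InRed G R y →
    (MeetsNbhdBesides G R y x × ¬ MeetsNbhdBesides G R x y)
    ⊎ (¬ MeetsNbhdBesides G R y x × MeetsNbhdBesides G R x y)
  exactly-one y-red with meetsNbhdBesides? G R y x | meetsNbhdBesides? G R x y
  ... | yes side₁ | _ = inj₁ (side₁ , λ side₂ → ¬both (side₁ , side₂))
  ... | no ¬side₁ | yes side₂ = inj₂ (¬side₁ , side₂)
  ... | no ¬side₁ | no ¬side₂ =
    ⊥-elim (C₃C₅-free⇒some-side G free min-red x-red y-red xy N[y]≢⁅x⁆ ¬side₁ ¬side₂)
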